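{- Let $\lambda,\mu$ be partitions with at most $n$ parts and $r,s\in\mathbb Z_{>0}^n$ with $r_i\le r_{i+1}$ and $s_i\le s_{i+1}$ for each $1\le i\le n-1$ with $\mu_i<\lambda_{i+1}$. If $\mu_k<\lambda_k$ and $r_k>s_k$ for some $k$, then each of \[ g^{\mathrm{row}(r,s)}_{\lambda/\mu}(x;\alpha,\beta),\ \det\Big(h_{\lambda_i-\mu_j-i+j}\big[X_{[r_j,s_i]}-A_{\lambda_i-1}+A_{\mu_j}+B_{i-1}-B_{j-1}\big]\Big)_{i,j=1}^n, \] \[ g^{\mathrm{col}(r,s)}_{\lambda'/\mu'}(x;\alpha,\beta),\ \det\Big(e_{\lambda_i-\mu_j-i+j}\big[X_{[r_j,s_i]}-A_{i-1}+A_{j-1}+B_{\lambda_i-1}-B_{\mu_j}\big]\Big)_{i,j=1}^n \] is equal to $0$.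
   Context: Indeterminates $x=(x_1,x_2,\dots)$, $\alpha=(\alpha_i)$, $\beta=(\beta_i)$; $A_m=\alpha_1+\dots+\alpha_m$, $B_m=\beta_1+\dots+\beta_m$ ($=0$ for $m\le0$); $X_{[r,s]}=x_r+\dots+x_s$ ($=0$ if $r>s$). For a formal $\mathbb Z$-linear combination $Z=\sum_vc_vv$ of finitely many indeterminates, $h_m[Z]$ and $e_m[Z]$ are the coefficients of $t^m$ in $\prod_v(1-vt)^{ -c_v}$ and $\prod_v(1+vt)^{c_v}$ (both $0$ for $m<0$). Partitions are padded with zeros. The shape $\lambda/\mu$ consists of cells $(i,j)$ with $\mu_i<j\le\lambda_i$, and $\lambda'/\mu'$ of cells $(i,j)$ with $\mu_j<i\le\lambda_j$; if $\mu\not\subseteq\lambda$ there are no fillings. A marked reverse plane partition of such a shape is a filling $T$ of the cells by positive integers weakly increasing along rows and columns, in which each entry $T(i,j)$ with $(i,j+1)$ a cell and $T(i,j)=T(i,j+1)$ may be marked; $\mathrm{wt}(T)=\prod w(i,j)$ with $w(i,j)=-\alpha_j$ if marked, $\beta_{i-1}$ if unmarked with $(i-1,j)$ a cell and $T(i,j)=T(i-1,j)$ as integers, and $x_{T(i,j)}$ otherwise. $g^{\mathrm{row}(r,s)}_{\lambda/\mu}$ sums $\mathrm{wt}(T)$ over such $T$ of shape $\lambda/\mu$ with $r_i\le T(i,j)\le s_i$; $g^{\mathrm{col}(r,s)}_{\lambda'/\mu'}$ sums over such $T$ of shape $\lambda'/\mu'$ with $r_j\le T(i,j)\le s_j$.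 -}

module Defs where

open import Level using (0ℓ)
open import Algebra.Bundles using (CommutativeRing)
open import Data.Nat as ℕ using (ℕ; zero; suc; _∸_; _≤ᵇ_; _≡ᵇ_)
open import Data.Bool using (Bool; true; false; _∧_; _∨_; not; if_then_else_)
open import Data.Fin as Fin using (Fin; toℕ; punchIn)
open import Data.List as List using (List; []; _∷_; _++_; map; concatMap; foldr; zip; allFin; upTo)
open import Data.Maybe using (Maybe; just; nothing)
open import Data.Product using (_×_; _,_; proj₁; proj₂)
open import Data.Integer using (ℤ; +_; -[1+_]; _⊖_)

-- the integers a, a+1, ..., b (empty if b < a)
range : ℕ → ℕ → List ℕ
range a b = map (a ℕ.+_) (upTo (suc b ∸ a))

filterB : {A : Set} → (A → Bool) → List A → List A
filterB p [] = []
filterB p (a ∷ as) = if p a then a ∷ filterB p as else filterB p as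

allB : {A : Set} → (A → Bool) → List A → Bool
allB p = foldr (λ a b → p a ∧ b) true

-- Indeterminates and formal Z-linear combinations ("alphabets").
-- xv k = x_k, av k = α_k, bv k = β_k (indices 1-based as in the paper).
-- An alphabet is a list of signed indeterminates (true = +v, false = -v);
-- Z = Σ_v c_v v where c_v = #(+v entries) - #(-v entries).

data Var : Set where
  xv av bv : ℕ → Var

Alphabet : Set
Alphabet = List (Bool × Var)

negA : Alphabet → Alphabet
negA = map (λ p → (not (proj₁ p) , proj₂ p))

Xr : ℕ → ℕ → Alphabet
Xr r s = map (λ k → (true , xv k)) (range r s)

Am : ℕ → Alphabet
Am m = map (λ k → (true , av k)) (range 1 m)

Bm : ℕ → Alphabet
Bm m = map (λ k → (true , bv k)) (range 1 m)

-- Cells of a (skew) shape: 1-based row, 1-based column,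
-- and the allowed range [lo, hi] of the entry in this cell.

record Cell : Set where
  constructor cell
  field
    row col lo hi : ℕ
open Cell public

rowCells : (n : ℕ) → (la mu r s : Fin n → ℕ) → List Cell
rowCells n la mu r s =
  concatMap (λ i → map (λ j → cell (suc (toℕ i)) j (r i) (s i)) (range (suc (mu i)) (la i)))
            (allFin n)

colCells : (n : ℕ) → (la mu r s : Fin n → ℕ) → List Cell
colCells n la mu r s =
  concatMap (λ j → map (λ i → cell i (suc (toℕ j)) (r j) (s j)) (range (suc (mu j)) (la j)))
            (allFin n)

containedB : (n : ℕ) → (la mu : Fin n → ℕ) → Bool
containedB n la mu = allB (λ i → mu i ≤ᵇ la i) (allFin n)

-- a filled shape: each cell with (entry, marked?)
Filled : Set
Filled = List (Cell × (ℕ × Bool))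

candidates : List Cell → List (List (ℕ × Bool))
candidates [] = [] ∷ []
candidates (c ∷ cs) =
  let rest = candidates cs in
  concatMap (λ v → concatMap (λ b → map ((v , b) ∷_) rest) (true ∷ false ∷ []))
            (range (lo c) (hi c))

lookupT : Filled → ℕ → ℕ → Maybe ℕ
lookupT [] a b = nothing
lookupT ((c , (v , m)) ∷ F) a b =
  if (row c ≡ᵇ a) ∧ (col c ≡ᵇ b) then just v else lookupT F a b

eqM : Maybe ℕ → ℕ → Bool
eqM nothing v = false
eqM (just u) v = u ≡ᵇ v

implies : Bool → Bool → Bool
implies a b = not a ∨ b

monotoneB : Filled → Bool
monotoneB F =
  allB (λ p → allB (λ q →
      let c = proj₁ p ; v = proj₁ (proj₂ p) ; c' = proj₁ q ; v' = proj₁ (proj₂ q) in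
      implies ((row c ≡ᵇ row c') ∧ (col c ≤ᵇ col c')) (v ≤ᵇ v')
      ∧ implies ((col c ≡ᵇ col c') ∧ (row c ≤ᵇ row c')) (v ≤ᵇ v')) F) F

marksOkB : Filled → Bool
marksOkB F =
  allB (λ p → let c = proj₁ p ; v = proj₁ (proj₂ p) ; m = proj₂ (proj₂ p) in
              implies m (eqM (lookupT F (row c) (suc (col c))) v)) F

validB : Filled → Bool
validB F = monotoneB F ∧ marksOkB F

-- Everything evaluated in an arbitrary commutative ring R with arbitrary
-- values for the indeterminates x_k, α_k, β_k.

module WithRing (R : CommutativeRing 0ℓ 0ℓ) (x α β : ℕ → CommutativeRing.Carrier R) where
  open CommutativeRing R using (Carrier; _+_; _*_; -_; _-_; 0#; 1#)

  sumL : List Carrier → Carrier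
  sumL = foldr _+_ 0#

  prodL : List Carrier → Carrier
  prodL = foldr _*_ 1#

  pow : Carrier → ℕ → Carrier
  pow a zero = 1#
  pow a (suc k) = a * pow a k

  val : Var → Carrier
  val (xv k) = x k
  val (av k) = α k
  val (bv k) = β k

  -- h_m[Z] : coefficient of t^m in Π_v (1 - v t)^(-c_v)
  hN : ℕ → Alphabet → Carrier
  hN zero [] = 1#
  hN (suc m) [] = 0#
  hN m ((true , v) ∷ Z) =
    sumL (map (λ k → pow (val v) k * hN (m ∸ k) Z) (range 0 m))
  hN zero ((false , v) ∷ Z) = hN zero Z
  hN (suc m) ((false , v) ∷ Z) = hN (suc m) Z - val v * hN m Z

  -- e_m[Z] : coefficient of t^m in Π_v (1 + v t)^(c_v)
  eN : ℕ → Alphabet → Carrier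
  eN zero [] = 1#
  eN (suc m) [] = 0#
  eN zero ((true , v) ∷ Z) = eN zero Z
  eN (suc m) ((true , v) ∷ Z) = eN (suc m) Z + val v * eN m Z
  eN m ((false , v) ∷ Z) =
    sumL (map (λ k → pow (- val v) k * eN (m ∸ k) Z) (range 0 m))

  hZ : ℤ → Alphabet → Carrier
  hZ (+ m) Z = hN m Z
  hZ -[1+ _ ] Z = 0#

  eZ : ℤ → Alphabet → Carrier
  eZ (+ m) Z = eN m Z
  eZ -[1+ _ ] Z = 0#

  sgn : ℕ → Carrier
  sgn zero = 1#
  sgn (suc k) = - sgn k

  det : (n : ℕ) → (Fin n → Fin n → Carrier) → Carrier
  det zero M = 1#
  det (suc n) M =
    sumL (map (λ j → sgn (toℕ j) * (M Fin.zero j * det n (λ a b → M (Fin.suc a) (punchIn j b))))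
              (allFin (suc n)))

  cellWeight : Filled → Cell × (ℕ × Bool) → Carrier
  cellWeight F (c , (v , true)) = - α (col c)
  cellWeight F (c , (v , false)) =
    if eqM (lookupT F (row c ∸ 1) (col c)) v then β (row c ∸ 1) else x v

  wt : Filled → Carrier
  wt F = prodL (map (cellWeight F) F)

  gSum : Bool → List Cell → Carrier
  gSum false cs = 0#
  gSum true cs = sumL (map wt (filterB validB (map (zip cs) (candidates cs))))

  gRow : (n : ℕ) → (la mu r s : Fin n → ℕ) → Carrier
  gRow n la mu r s = gSum (containedB n la mu) (rowCells n la mu r s)

  gCol : (n : ℕ) → (la mu r s : Fin n → ℕ) → Carrier
  gCol n la mu r s = gSum (containedB n la mu) (colCells n la mu r s)

  -- det( h_{λ_i-μ_j-i+j}[X_[r_j,s_i] - A_{λ_i-1} + A_{μ_j} + B_{i-1} - B_{j-1}] )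
  -- (Fin indices are 0-based: toℕ i = i - 1)
  detH : (n : ℕ) → (la mu r s : Fin n → ℕ) → Carrier
  detH n la mu r s = det n (λ i j →
    hZ ((la i ℕ.+ toℕ j) ⊖ (mu j ℕ.+ toℕ i))
       (Xr (r j) (s i) ++ negA (Am (la i ∸ 1)) ++ Am (mu j) ++ Bm (toℕ i) ++ negA (Bm (toℕ j))))

  detE : (n : ℕ) → (la mu r s : Fin n → ℕ) → Carrier
  detE n la mu r s = det n (λ i j →
    eZ ((la i ℕ.+ toℕ j) ⊖ (mu j ℕ.+ toℕ i))
       (Xr (r j) (s i) ++ negA (Am (toℕ i)) ++ Am (toℕ j) ++ Bm (la i ∸ 1) ++ negA (Bm (mu j))))

IsPartition : (n : ℕ) → (Fin n → ℕ) → Set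
IsPartition n la = (i j : Fin n) → i Fin.≤ j → la j ℕ.≤ la i

{-# OPTIONS --safe #-}
module Submission where

-- The fillings vanish because every cell of row (column) k needs an entry in the empty
-- interval [r_k, s_k].  For the determinants, rows l and l+1 overlap when μ_l < λ_{l+1}, and
-- along overlapping rows r and s weakly increase.  If [p, q] is the maximal unbroken run of
-- overlapping rows through k, then the rows [p, k] ∪ (q, n] and the columns [1, p) ∪ [k, q],
-- n + 1 in all, span a block of zero entries: either the degree λ_i - μ_j - i + j is negative
-- (a break at p - 1 or q lies between j and i), or X_[r_j, s_i] is empty and, after +A_{μ_j}
-- cancels against -A_{λ_i - 1} and +B_{i-1} against -B_{j-1}, fewer letters than the degree
-- remain, all of one sign.  The cancellation takes place on coefficient sequences, where each
-- letter v multiplies or divides by 1 - v t, and these operations commute.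

open import Defs
open import Level using (0ℓ)
open import Algebra.Bundles using (CommutativeRing)
open import Data.Nat using (ℕ; suc; _≤_; _<_)
open import Data.Fin using (Fin; toℕ)
open import Data.Product using (_×_; Σ-syntax)
open import Relation.Binary.PropositionalEquality using (_≡_)

import Algebra.Properties.CommutativeSemigroup as CommSemigroupProperties
open import Data.Bool using (Bool; true; false; not; _xor_; T)
open import Data.Bool.Properties using (not-distribʳ-xor; xor-same; not-involutive)
open import Data.Empty using (⊥-elim)
open import Data.Fin using (zero; suc; punchIn; fromℕ<)
import Data.Fin.Properties as FinP
open import Data.Integer as ℤ using (-[1+_]; _⊖_)
import Data.Integer.Properties as ℤP
open import Data.List using (List; []; _∷_; _++_; foldr; map; length; concatMap; applyUpTo; upTo; allFin)
import Data.List.Properties as LP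
open import Data.List.Relation.Unary.All as All using (All; []; _∷_)
import Data.List.Relation.Unary.All.Properties as AllP
open import Data.List.Relation.Unary.Any using (Any; here; there)
import Data.List.Relation.Unary.Any.Properties as AnyP
open import Data.Nat as Nat using (zero; _∸_; _≥_; _≤′_; ≤′-refl; ≤′-step; z≤n; s≤s; _≤?_; _<?_)
import Data.Nat.Properties as ℕP
open import Data.Nat.Tactic.RingSolver using (solve-∀)
open import Data.Product using (_,_; proj₁; proj₂; ∃-syntax)
open import Data.Sum as Sum using (_⊎_; inj₁; inj₂)
open import Data.Unit using (tt)
open import Function using (_∘_)
open import Relation.Binary.Bundles using (Setoid)
open import Relation.Binary.Core using (_Preserves_⟶_)
open import Relation.Binary.Definitions using (tri<; tri≈; tri>)
open import Relation.Binary.PropositionalEquality using (refl)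
import Relation.Binary.PropositionalEquality as ≡
import Relation.Binary.Reasoning.Setoid as SetoidReasoning
open import Relation.Nullary using (¬_; Dec; yes; no; ¬?; contradiction)
open import Relation.Nullary.Decidable using (_×-dec_; _⊎-dec_; decidable-stable; T?; ⌊_⌋; toWitness; fromWitness)

module ℕ+ = CommSemigroupProperties ℕP.+-commutativeSemigroup

module Alphabets where
  open Nat using (_+_)

  negA-involutive : ∀ Z → negA (negA Z) ≡ Z
  negA-involutive Z =
    ≡.trans (≡.sym (LP.map-∘ Z)) (≡.trans (LP.map-cong (λ { (b , v) → ≡.cong (_, v) (not-involutive b) }) Z) (LP.map-id Z))

  length-negA : ∀ Z → length (negA Z) ≡ length Z
  length-negA = LP.length-map _

  Positive : Alphabet → Set
  Positive = All ((_≡ true) ∘ proj₁)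

  negA-positive : ∀ {Z} → Positive Z → All ((_≡ false) ∘ proj₁) (negA Z)
  negA-positive Z⁺ = AllP.map⁺ (All.map (≡.cong not) Z⁺)

  initial : (ℕ → Var) → ℕ → Alphabet
  initial f m = map (λ k → (true , f k)) (range 1 m)

  applyUpTo-+ : ∀ {A : Set} (f : ℕ → A) m d → applyUpTo f (m + d) ≡ applyUpTo f m ++ applyUpTo (f ∘ (m +_)) d
  applyUpTo-+ f zero    d = refl
  applyUpTo-+ f (suc m) d = ≡.cong (f 0 ∷_) (applyUpTo-+ (f ∘ suc) m d)

  initial-+ : ∀ f m d → Σ[ W ∈ Alphabet ] (initial f (m + d) ≡ initial f m ++ W) × Positive W × length W ≡ d
  initial-+ f m d = letters (map suc (applyUpTo (m +_) d)) , split , AllP.map⁺ (All.universal (λ _ → refl) _) , size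
    where
    letters : List ℕ → Alphabet
    letters = map (λ k → (true , f k))
    split : initial f (m + d) ≡ initial f m ++ letters (map suc (applyUpTo (m +_) d))
    split = ≡.trans (≡.cong (letters ∘ map suc) (applyUpTo-+ (λ k → k) m d))
           (≡.trans (≡.cong letters (LP.map-++ suc (upTo m) _)) (LP.map-++ _ (map suc (upTo m)) _))
    size : length (letters (map suc (applyUpTo (m +_) d))) ≡ d
    size = ≡.trans (LP.length-map _ (map suc (applyUpTo (m +_) d)))
             (≡.trans (LP.length-map suc (applyUpTo (m +_) d)) (LP.length-applyUpTo (m +_) d))

  range-empty : ∀ {a b} → b < a → range a b ≡ []
  range-empty {a} b<a = ≡.cong (λ d → map (a +_) (upTo d)) (ℕP.m≤n⇒m∸n≡0 b<a)

  Xr-empty : ∀ {r s} → s < r → Xr r s ≡ []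
  Xr-empty s<r = ≡.cong (map _) (range-empty s<r)

open Alphabets

module Counting where
  open Nat using (_+_)

  bit : Bool → ℕ
  bit true  = 1
  bit false = 0

  count : ∀ {n} → (Fin n → Bool) → ℕ
  count {zero}  P = 0
  count {suc n} P = bit (P zero) + count (P ∘ suc)

  count-punchIn : ∀ {n} (P : Fin (suc n) → Bool) j → count P ≡ bit (P j) + count (P ∘ punchIn j)
  count-punchIn         P zero    = refl
  count-punchIn {suc n} P (suc j) =
    ≡.trans (≡.cong (bit (P zero) +_) (count-punchIn (P ∘ suc) j)) (ℕ+.x∙yz≈y∙xz (bit (P zero)) (bit (P (suc j))) _)

  count₂-suc : ∀ {n} (I J : Fin (suc n) → Bool) →
               count I + count J ≡ (bit (I zero) + bit (J zero)) + (count (I ∘ suc) + count (J ∘ suc))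
  count₂-suc I J = ℕ+.interchange (bit (I zero)) (count (I ∘ suc)) (bit (J zero)) (count (J ∘ suc))

  bit-cover : ∀ {a b} → T a ⊎ T b → 1 ≤ bit a + bit b
  bit-cover {true}          _        = s≤s z≤n
  bit-cover {false} {true}  _        = s≤s z≤n
  bit-cover {false} {false} (inj₁ ())
  bit-cover {false} {false} (inj₂ ())

  bit-both : ∀ {a b} → T a → T b → 2 ≤ bit a + bit b
  bit-both {true} {true} _ _ = ℕP.≤-refl

  bit-not-both : ∀ a b → ¬ (T a × T b) → bit a + bit b ≤ 1
  bit-not-both true  true  ¬both = ⊥-elim (¬both (tt , tt))
  bit-not-both true  false _     = ℕP.≤-refl
  bit-not-both false true  _     = ℕP.≤-refl
  bit-not-both false false _     = z≤n

  cover⇒count≥ : ∀ {n} (I J : Fin n → Bool) → (∀ t → T (I t) ⊎ T (J t)) → n ≤ count I + count J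
  cover⇒count≥ {zero}  I J cover = z≤n
  cover⇒count≥ {suc n} I J cover = ≡.subst (suc n ≤_) (≡.sym (count₂-suc I J))
    (ℕP.+-mono-≤ (bit-cover (cover zero)) (cover⇒count≥ (I ∘ suc) (J ∘ suc) (cover ∘ suc)))

  cover⇒count> : ∀ {n} (I J : Fin n → Bool) → (∀ t → T (I t) ⊎ T (J t)) →
                 ∀ k → T (I k) → T (J k) → n < count I + count J
  cover⇒count> {suc n} I J cover zero    k∈I k∈J = ≡.subst (suc (suc n) ≤_) (≡.sym (count₂-suc I J))
    (ℕP.+-mono-≤ (bit-both k∈I k∈J) (cover⇒count≥ (I ∘ suc) (J ∘ suc) (cover ∘ suc)))
  cover⇒count> {suc n} I J cover (suc k) k∈I k∈J = ≡.subst (suc (suc n) ≤_) (≡.sym (count₂-suc I J))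
    (ℕP.+-mono-≤ (bit-cover (cover zero)) (cover⇒count> (I ∘ suc) (J ∘ suc) (cover ∘ suc) k k∈I k∈J))

  count-minor : ∀ {n} (I J : Fin (suc n) → Bool) j → ¬ (T (I zero) × T (J j)) →
                suc n < count I + count J → n < count (I ∘ suc) + count (J ∘ punchIn j)
  count-minor {n} I J j ¬both large = ℕP.≤-pred (begin
    suc (suc n)
      ≤⟨ large ⟩
    count I + count J
      ≡⟨ ≡.cong (count I +_) (count-punchIn J j) ⟩
    (bit (I zero) + count (I ∘ suc)) + (bit (J j) + count (J ∘ punchIn j))
      ≡⟨ ℕ+.interchange (bit (I zero)) (count (I ∘ suc)) (bit (J j)) (count (J ∘ punchIn j)) ⟩
    (bit (I zero) + bit (J j)) + (count (I ∘ suc) + count (J ∘ punchIn j))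
      ≤⟨ ℕP.+-monoˡ-≤ _ (bit-not-both (I zero) (J j) ¬both) ⟩
    1 + (count (I ∘ suc) + count (J ∘ punchIn j)) ∎)
    where open ℕP.≤-Reasoning

open Counting

module Fillings where
  open Nat using (_+_)

  Inverted : Cell → Set
  Inverted c = hi c < lo c

  concatMap-nil : ∀ {A B : Set} (xs : List A) → concatMap (λ _ → []) xs ≡ [] {A = B}
  concatMap-nil []       = refl
  concatMap-nil (_ ∷ xs) = concatMap-nil xs

  candidates-empty : ∀ {cs} → Any Inverted cs → candidates cs ≡ []
  candidates-empty {c ∷ _} (here hi<lo) = ≡.cong (concatMap _) (range-empty hi<lo)
  candidates-empty {c ∷ _} (there inv) rewrite candidates-empty inv = concatMap-nil (range (lo c) (hi c))

  Any-map-range : ∀ {B : Set} {P : B → Set} (g : ℕ → B) {a b} → a ≤ b → (∀ j → P (g j)) →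
                  Any P (map g (range a b))
  Any-map-range {P = P} g {a} a≤b Pg =
    ≡.subst (λ d → Any P (map g (map (a +_) (upTo d)))) (≡.sym (ℕP.+-∸-assoc 1 a≤b)) (here (Pg (a + 0)))

  rowCells-inverted : ∀ {n} la mu r s (k : Fin n) → mu k < la k → s k < r k → Any Inverted (rowCells n la mu r s)
  rowCells-inverted la mu r s k mu<la s<r = AnyP.concatMap⁺ _ (AnyP.tabulate⁺ k (Any-map-range _ mu<la (λ _ → s<r)))

  colCells-inverted : ∀ {n} la mu r s (k : Fin n) → mu k < la k → s k < r k → Any Inverted (colCells n la mu r s)
  colCells-inverted la mu r s k mu<la s<r = AnyP.concatMap⁺ _ (AnyP.tabulate⁺ k (Any-map-range _ mu<la (λ _ → s<r)))

open Fillings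

module ZeroEntries where
  open Nat using (_+_)

  ZeroEntry : (la mu i j r s : ℕ) → Set
  ZeroEntry la mu i j r s = la + j < mu + i ⊎ (i ≤ j × mu < la × s < r)

  ⊖-negative : ∀ {p q} → p < q → ∃[ d ] p ⊖ q ≡ -[1+ d ]
  ⊖-negative {zero}  {suc q} _         = q , refl
  ⊖-negative {suc p} {suc q} (s≤s p<q) with ⊖-negative p<q
  ... | d , eq = d , ≡.trans (ℤP.[1+m]⊖[1+n]≡m⊖n p q) eq

  entry-degree : ∀ mu a i b → (suc mu + a + (i + b)) ⊖ (mu + i) ≡ ℤ.+ suc (a + b)
  entry-degree mu a i b = ≡.trans (≡.cong (_⊖ (mu + i)) (shift mu a i b))
    (≡.trans (ℤP.⊖-≥ (ℕP.m≤m+n (mu + i) _)) (≡.cong ℤ.+_ (ℕP.m+n∸m≡n (mu + i) _)))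
    where
    shift : ∀ mu a i b → suc mu + a + (i + b) ≡ (mu + i) + suc (a + b)
    shift = solve-∀

open ZeroEntries

module Series (R : CommutativeRing 0ℓ 0ℓ) where
  open CommutativeRing R hiding (zero) renaming (refl to ≈-refl; sym to ≈-sym; trans to ≈-trans)
  open import Algebra.Properties.Group +-group using (//-rightDividesˡ; //-rightDividesʳ)
  open import Algebra.Properties.AbelianGroup +-abelianGroup using (⁻¹-anti-homo‿-)
  open import Algebra.Properties.CommutativeSemigroup +-commutativeSemigroup using (interchange; xy∙z≈xz∙y)
  open import Algebra.Properties.CommutativeSemigroup *-commutativeSemigroup using (x∙yz≈y∙xz)
  open import Algebra.Properties.Ring ring using (x[y-z]≈xy-xz)

  Seq : Set
  Seq = ℕ → Carrier

  infix 4 _≋_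
  _≋_ : Seq → Seq → Set
  f ≋ g = ∀ m → f m ≈ g m

  ≋-setoid : Setoid 0ℓ 0ℓ
  ≋-setoid = record
    { _≈_ = _≋_
    ; isEquivalence = record
      { refl = λ m → ≈-refl ; sym = λ f≋g m → ≈-sym (f≋g m) ; trans = λ f≋g g≋h m → ≈-trans (f≋g m) (g≋h m) }
    }

  module ≋-Reasoning = SetoidReasoning ≋-setoid

  -- A sequence f stands for the power series Σ f m tᵐ; mulFactor c and divFactor c
  -- multiply and divide it by 1 - c t.
  mulFactor : Carrier → Seq → Seq
  mulFactor c f zero    = f zero
  mulFactor c f (suc m) = f (suc m) - c * f m

  divFactor : Carrier → Seq → Seq
  divFactor c f zero    = f zero
  divFactor c f (suc m) = f (suc m) + c * divFactor c f m

  mulFactor-cong : ∀ c {f g} → f ≋ g → mulFactor c f ≋ mulFactor c g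
  mulFactor-cong c f≋g zero    = f≋g zero
  mulFactor-cong c f≋g (suc m) = +-cong (f≋g (suc m)) (-‿cong (*-congˡ (f≋g m)))

  divFactor-cong : ∀ c {f g} → f ≋ g → divFactor c f ≋ divFactor c g
  divFactor-cong c f≋g zero    = f≋g zero
  divFactor-cong c f≋g (suc m) = +-cong (f≋g (suc m)) (*-congˡ (divFactor-cong c f≋g m))

  mulFactor-divFactor : ∀ c f → mulFactor c (divFactor c f) ≋ f
  mulFactor-divFactor c f zero    = ≈-refl
  mulFactor-divFactor c f (suc m) = //-rightDividesʳ (c * divFactor c f m) (f (suc m))

  divFactor-mulFactor : ∀ c f → divFactor c (mulFactor c f) ≋ f
  divFactor-mulFactor c f zero    = ≈-refl
  divFactor-mulFactor c f (suc m) =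
    ≈-trans (+-congˡ (*-congˡ (divFactor-mulFactor c f m))) (//-rightDividesˡ (c * f m) (f (suc m)))

  mulFactor-injective : ∀ c {f g} → mulFactor c f ≋ mulFactor c g → f ≋ g
  mulFactor-injective c {f} {g} eq m = begin
    f m                           ≈⟨ divFactor-mulFactor c f m ⟨
    divFactor c (mulFactor c f) m ≈⟨ divFactor-cong c eq m ⟩
    divFactor c (mulFactor c g) m ≈⟨ divFactor-mulFactor c g m ⟩
    g m                           ∎
    where open SetoidReasoning setoid

  sub-sub-comm : ∀ a p q r → (a - p) - (q - r) ≈ (a - q) - (p - r)
  sub-sub-comm a p q r = begin
    (a - p) - (q - r)     ≈⟨ +-congˡ (⁻¹-anti-homo‿- q r) ⟩
    (a - p) + (r - q)     ≈⟨ interchange a (- p) r (- q) ⟩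
    (a + r) + (- p - q)   ≈⟨ +-congˡ (+-comm (- p) (- q)) ⟩
    (a + r) + (- q - p)   ≈⟨ interchange a (- q) r (- p) ⟨
    (a - q) + (r - p)     ≈⟨ +-congˡ (⁻¹-anti-homo‿- p r) ⟨
    (a - q) - (p - r)     ∎
    where open SetoidReasoning setoid

  mulFactor-comm : ∀ c d f → mulFactor c (mulFactor d f) ≋ mulFactor d (mulFactor c f)
  mulFactor-comm c d f zero          = ≈-refl
  mulFactor-comm c d f (suc zero)    = xy∙z≈xz∙y (f 1) (- (d * f 0)) (- (c * f 0))
  mulFactor-comm c d f (suc (suc m)) = begin
    (f (suc (suc m)) - d * f (suc m)) - c * (f (suc m) - d * f m)
      ≈⟨ +-congˡ (-‿cong (x[y-z]≈xy-xz c (f (suc m)) (d * f m))) ⟩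
    (f (suc (suc m)) - d * f (suc m)) - (c * f (suc m) - c * (d * f m))
      ≈⟨ sub-sub-comm (f (suc (suc m))) (d * f (suc m)) (c * f (suc m)) (c * (d * f m)) ⟩
    (f (suc (suc m)) - c * f (suc m)) - (d * f (suc m) - c * (d * f m))
      ≈⟨ +-congˡ (-‿cong (+-congˡ (-‿cong (x∙yz≈y∙xz c d (f m))))) ⟩
    (f (suc (suc m)) - c * f (suc m)) - (d * f (suc m) - d * (c * f m))
      ≈⟨ +-congˡ (-‿cong (x[y-z]≈xy-xz d (f (suc m)) (c * f m))) ⟨
    (f (suc (suc m)) - c * f (suc m)) - d * (f (suc m) - c * f m)
      ∎
    where open SetoidReasoning setoid

  mulFactor-divFactor-comm : ∀ c d f → mulFactor c (divFactor d f) ≋ divFactor d (mulFactor c f)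
  mulFactor-divFactor-comm c d f = mulFactor-injective d (begin
    mulFactor d (mulFactor c (divFactor d f)) ≈⟨ mulFactor-comm d c _ ⟩
    mulFactor c (mulFactor d (divFactor d f)) ≈⟨ mulFactor-cong c (mulFactor-divFactor d f) ⟩
    mulFactor c f                             ≈⟨ mulFactor-divFactor d (mulFactor c f) ⟨
    mulFactor d (divFactor d (mulFactor c f)) ∎)
    where open ≋-Reasoning

  divFactor-comm : ∀ c d f → divFactor c (divFactor d f) ≋ divFactor d (divFactor c f)
  divFactor-comm c d f = mulFactor-injective c (begin
    mulFactor c (divFactor c (divFactor d f)) ≈⟨ mulFactor-divFactor c _ ⟩
    divFactor d f                             ≈⟨ divFactor-cong d (mulFactor-divFactor c f) ⟨
    divFactor d (mulFactor c (divFactor c f)) ≈⟨ mulFactor-divFactor-comm c d _ ⟨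
    mulFactor c (divFactor d (divFactor c f)) ∎)
    where open ≋-Reasoning

  factor : Bool → Carrier → Seq → Seq
  factor true  = divFactor
  factor false = mulFactor

  factor-cong : ∀ b c {f g} → f ≋ g → factor b c f ≋ factor b c g
  factor-cong true  = divFactor-cong
  factor-cong false = mulFactor-cong

  factor-comm : ∀ b c b′ d f → factor b c (factor b′ d f) ≋ factor b′ d (factor b c f)
  factor-comm true  c true  d f = divFactor-comm c d f
  factor-comm true  c false d f m = ≈-sym (mulFactor-divFactor-comm d c f m)
  factor-comm false c true  d f = mulFactor-divFactor-comm c d f
  factor-comm false c false d f = mulFactor-comm c d f

  factor-cancel : ∀ b c f → factor b c (factor (not b) c f) ≋ f
  factor-cancel true  = divFactor-mulFactor
  factor-cancel false = mulFactor-divFactor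

  VanishesFrom : ℕ → Seq → Set
  VanishesFrom d f = ∀ m → d ≤ m → f m ≈ 0#

  mulFactor-vanishes : ∀ c {d f} → VanishesFrom d f → VanishesFrom (suc d) (mulFactor c f)
  mulFactor-vanishes c {f = f} f↓ (suc m) (s≤s d≤m) = begin
    f (suc m) - c * f m ≈⟨ +-cong (f↓ (suc m) (ℕP.m≤n⇒m≤1+n d≤m)) (-‿cong (*-congˡ (f↓ m d≤m))) ⟩
    0# - c * 0#         ≈⟨ +-congˡ (-‿cong (zeroʳ c)) ⟩
    0# - 0#             ≈⟨ -‿inverseʳ 0# ⟩
    0#                  ∎
    where open SetoidReasoning setoid

  δ : Seq
  δ zero    = 1#
  δ (suc m) = 0#

  δ-vanishes : VanishesFrom 1 δ
  δ-vanishes (suc m) _ = ≈-refl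

  -- ε = true swaps the roles of +v and -v; together with κ = - val this turns h into e,
  -- since 1 + v t = 1 - (- v) t.
  module Letters (ε : Bool) (κ : Var → Carrier) where

    letter : Bool × Var → Seq → Seq
    letter (b , v) = factor (ε xor b) (κ v)

    letter-cong : ∀ l {f g} → f ≋ g → letter l f ≋ letter l g
    letter-cong (b , v) = factor-cong (ε xor b) (κ v)

    ops : Alphabet → Seq → Seq
    ops Z f = foldr letter f Z

    ops-++ : ∀ Z Z′ f → ops (Z ++ Z′) f ≡ ops Z (ops Z′ f)
    ops-++ Z Z′ f = LP.foldr-++ letter f Z Z′

    ops-negA-++ : ∀ Z Z′ f → ops (negA (Z ++ Z′)) f ≡ ops (negA Z) (ops (negA Z′) f)
    ops-negA-++ Z Z′ f = ≡.trans (≡.cong (λ Y → ops Y f) (LP.map-++ _ Z Z′)) (ops-++ (negA Z) (negA Z′) f)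

    ops-++₄ : ∀ A B C D f → ops (A ++ B ++ C ++ D) f ≡ ops A (ops B (ops C (ops D f)))
    ops-++₄ A B C D f rewrite ops-++ A (B ++ C ++ D) f | ops-++ B (C ++ D) f | ops-++ C D f = refl

    ops-cong : ∀ Z {f g} → f ≋ g → ops Z f ≋ ops Z g
    ops-cong []      f≋g = f≋g
    ops-cong (l ∷ Z) f≋g = letter-cong l (ops-cong Z f≋g)

    letter-ops-comm : ∀ l Z f → letter l (ops Z f) ≋ ops Z (letter l f)
    letter-ops-comm l       []       f m = ≈-refl
    letter-ops-comm (b , v) (l′ ∷ Z) f = begin
      letter (b , v) (letter l′ (ops Z f))
        ≈⟨ factor-comm (ε xor b) (κ v) (ε xor proj₁ l′) (κ (proj₂ l′)) (ops Z f) ⟩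
      letter l′ (letter (b , v) (ops Z f))
        ≈⟨ letter-cong l′ (letter-ops-comm (b , v) Z f) ⟩
      letter l′ (ops Z (letter (b , v) f)) ∎
      where open ≋-Reasoning

    ops-comm : ∀ Z Z′ f → ops Z (ops Z′ f) ≋ ops Z′ (ops Z f)
    ops-comm []      Z′ f m = ≈-refl
    ops-comm (l ∷ Z) Z′ f = begin
      letter l (ops Z (ops Z′ f)) ≈⟨ letter-cong l (ops-comm Z Z′ f) ⟩
      letter l (ops Z′ (ops Z f)) ≈⟨ letter-ops-comm l Z′ (ops Z f) ⟩
      ops Z′ (letter l (ops Z f)) ∎
      where open ≋-Reasoning

    ops-cancel : ∀ Z f → ops Z (ops (negA Z) f) ≋ f
    ops-cancel []            f m = ≈-refl
    ops-cancel ((b , v) ∷ Z) f = begin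
      letter (b , v) (ops Z (letter (not b , v) (ops (negA Z) f)))
        ≈⟨ letter-cong (b , v) (letter-ops-comm (not b , v) Z _) ⟨
      letter (b , v) (letter (not b , v) (ops Z (ops (negA Z) f)))
        ≈⟨ letter-cong (b , v) (letter-cong (not b , v) (ops-cancel Z f)) ⟩
      letter (b , v) (letter (not b , v) f)
        ≈⟨ ≡.subst (λ b′ → factor (ε xor b) (κ v) (factor b′ (κ v) f) ≋ f)
                 (not-distribʳ-xor ε b) (factor-cancel (ε xor b) (κ v) f) ⟩
      f ∎
      where open ≋-Reasoning

    ops-cancel′ : ∀ Z f → ops (negA Z) (ops Z f) ≋ f
    ops-cancel′ Z f = ≡.subst (λ Y → ops (negA Z) (ops Y f) ≋ f) (negA-involutive Z) (ops-cancel (negA Z) f)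

    ops-vanishes : ∀ Z {d f} → All ((_≡ ε) ∘ proj₁) Z → VanishesFrom d f →
                   VanishesFrom (length Z Nat.+ d) (ops Z f)
    ops-vanishes []            []         f↓ = f↓
    ops-vanishes ((_ , v) ∷ Z) (refl ∷ ps) f↓ =
      ≡.subst (λ b → VanishesFrom _ (factor b (κ v) (ops Z _))) (≡.sym (xor-same ε))
              (mulFactor-vanishes (κ v) (ops-vanishes Z ps f↓))

    ops-cancel-h : ∀ U W V Y f →
      ops (negA (U ++ W) ++ U ++ V ++ negA (V ++ Y)) f ≋ ops (negA W) (ops (negA Y) f)
    ops-cancel-h U W V Y f = begin
      ops (negA (U ++ W) ++ U ++ V ++ negA (V ++ Y)) f
        ≡⟨ ops-++₄ (negA (U ++ W)) U V (negA (V ++ Y)) f ⟩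
      ops (negA (U ++ W)) (ops U (ops V (ops (negA (V ++ Y)) f)))
        ≡⟨ ops-negA-++ U W _ ⟩
      ops (negA U) (ops (negA W) (ops U (ops V (ops (negA (V ++ Y)) f))))
        ≡⟨ ≡.cong (λ g → ops (negA U) (ops (negA W) (ops U (ops V g)))) (ops-negA-++ V Y f) ⟩
      ops (negA U) (ops (negA W) (ops U (ops V (ops (negA V) (ops (negA Y) f)))))
        ≈⟨ ops-cong (negA U) (ops-cong (negA W) (ops-cong U (ops-cancel V _))) ⟩
      ops (negA U) (ops (negA W) (ops U (ops (negA Y) f)))
        ≈⟨ ops-cong (negA U) (ops-comm (negA W) U _) ⟩
      ops (negA U) (ops U (ops (negA W) (ops (negA Y) f)))
        ≈⟨ ops-cancel′ U _ ⟩
      ops (negA W) (ops (negA Y) f) ∎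
      where open ≋-Reasoning

    ops-cancel-e : ∀ U W V Y f →
      ops (negA U ++ (U ++ W) ++ (V ++ Y) ++ negA V) f ≋ ops W (ops Y f)
    ops-cancel-e U W V Y f = begin
      ops (negA U ++ (U ++ W) ++ (V ++ Y) ++ negA V) f
        ≡⟨ ops-++₄ (negA U) (U ++ W) (V ++ Y) (negA V) f ⟩
      ops (negA U) (ops (U ++ W) (ops (V ++ Y) (ops (negA V) f)))
        ≡⟨ ≡.cong (ops (negA U)) (ops-++ U W _) ⟩
      ops (negA U) (ops U (ops W (ops (V ++ Y) (ops (negA V) f))))
        ≡⟨ ≡.cong (λ g → ops (negA U) (ops U (ops W g))) (ops-++ V Y _) ⟩
      ops (negA U) (ops U (ops W (ops V (ops Y (ops (negA V) f)))))
        ≈⟨ ops-cancel′ U _ ⟩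
      ops W (ops V (ops Y (ops (negA V) f)))
        ≈⟨ ops-cong W (ops-cong V (ops-comm Y (negA V) f)) ⟩
      ops W (ops V (ops (negA V) (ops Y f)))
        ≈⟨ ops-cong W (ops-cancel V _) ⟩
      ops W (ops Y f) ∎
      where open ≋-Reasoning

module Vanishing (R : CommutativeRing 0ℓ 0ℓ) (x α β : ℕ → CommutativeRing.Carrier R) where
  open CommutativeRing R hiding (zero) renaming (refl to ≈-refl; sym to ≈-sym; trans to ≈-trans)
  open import Algebra.Properties.Ring ring using (-‿involutive; -‿distribˡ-*)
  open SetoidReasoning setoid
  open WithRing R x α β
  open Series R

  module H = Letters false val
  module E = Letters true (-_ ∘ val)

  sumL-map-0 : ∀ {A : Set} {g : A → Carrier} → (∀ a → g a ≈ 0#) → ∀ xs → sumL (map g xs) ≈ 0#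
  sumL-map-0 g≈0 []       = ≈-refl
  sumL-map-0 g≈0 (a ∷ xs) = ≈-trans (+-cong (g≈0 a) (sumL-map-0 g≈0 xs)) (+-identityʳ 0#)

  sumL-map-*ˡ : ∀ {A : Set} c {g h : A → Carrier} → (∀ a → g a ≈ c * h a) →
                ∀ xs → sumL (map g xs) ≈ c * sumL (map h xs)
  sumL-map-*ˡ c         g≈ch []       = ≈-sym (zeroʳ c)
  sumL-map-*ˡ c {h = h} g≈ch (a ∷ xs) =
    ≈-trans (+-cong (g≈ch a) (sumL-map-*ˡ c g≈ch xs)) (≈-sym (distribˡ c (h a) _))

  geometric-sum : ∀ c f m → sumL (map (λ k → pow c k * f (m ∸ k)) (upTo (suc m))) ≈ divFactor c f m
  geometric-sum c f zero    = ≈-trans (+-identityʳ _) (*-identityˡ (f 0))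
  geometric-sum c f (suc m) = begin
    1# * f (suc m) + sumL (map g (applyUpTo suc (suc m)))
      ≡⟨ ≡.cong (λ ks → 1# * f (suc m) + sumL ks)
           (≡.trans (≡.cong (map g) (≡.sym (LP.map-upTo suc (suc m)))) (≡.sym (LP.map-∘ (upTo (suc m))))) ⟩
    1# * f (suc m) + sumL (map (g ∘ suc) (upTo (suc m)))
      ≈⟨ +-cong (*-identityˡ _) (sumL-map-*ˡ c (λ k → *-assoc c (pow c k) (f (m ∸ k))) (upTo (suc m))) ⟩
    f (suc m) + c * sumL (map (λ k → pow c k * f (m ∸ k)) (upTo (suc m)))
      ≈⟨ +-congˡ (*-congˡ (geometric-sum c f m)) ⟩
    f (suc m) + c * divFactor c f m ∎
    where
    g : ℕ → Carrier
    g k = pow c k * f (suc m ∸ k)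

  geometric-range : ∀ c f m → sumL (map (λ k → pow c k * f (m ∸ k)) (range 0 m)) ≈ divFactor c f m
  geometric-range c f m =
    ≈-trans (reflexive (≡.cong sumL (≡.sym (LP.map-∘ (upTo (suc m)))))) (geometric-sum c f m)

  hN≋ops : ∀ Z → (λ m → hN m Z) ≋ H.ops Z δ
  hN≋ops []                zero    = ≈-refl
  hN≋ops []                (suc m) = ≈-refl
  hN≋ops ((true , v) ∷ Z)  zero    =
    ≈-trans (geometric-range (val v) (λ m → hN m Z) 0) (divFactor-cong (val v) (hN≋ops Z) 0)
  hN≋ops ((true , v) ∷ Z)  (suc m) =
    ≈-trans (geometric-range (val v) (λ m → hN m Z) (suc m)) (divFactor-cong (val v) (hN≋ops Z) (suc m))
  hN≋ops ((false , v) ∷ Z) zero    = hN≋ops Z zero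
  hN≋ops ((false , v) ∷ Z) (suc m) = mulFactor-cong (val v) (hN≋ops Z) (suc m)

  eN≋ops : ∀ Z → (λ m → eN m Z) ≋ E.ops Z δ
  eN≋ops []                zero    = ≈-refl
  eN≋ops []                (suc m) = ≈-refl
  eN≋ops ((true , v) ∷ Z)  zero    = eN≋ops Z zero
  eN≋ops ((true , v) ∷ Z)  (suc m) =
    ≈-trans (+-congˡ (≈-trans (≈-sym (-‿involutive _)) (-‿cong (-‿distribˡ-* (val v) (eN m Z)))))
            (mulFactor-cong (- val v) (eN≋ops Z) (suc m))
  eN≋ops ((false , v) ∷ Z) zero    =
    ≈-trans (geometric-range (- val v) (λ m → eN m Z) 0) (divFactor-cong (- val v) (eN≋ops Z) 0)
  eN≋ops ((false , v) ∷ Z) (suc m) =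
    ≈-trans (geometric-range (- val v) (λ m → eN m Z) (suc m)) (divFactor-cong (- val v) (eN≋ops Z) (suc m))

  vanishing-bound : ∀ {a b m} → a Nat.+ b < m → a Nat.+ (b Nat.+ 1) ≤ m
  vanishing-bound {a} {b} {m} =
    ≡.subst (_≤ m) (≡.trans (≡.sym (ℕP.+-suc a b)) (≡.cong (a Nat.+_) (ℕP.+-comm 1 b)))

  h-vanishes : ∀ U {W} V {Y m} → Positive W → Positive Y → length W Nat.+ length Y < m →
               hN m (negA (U ++ W) ++ U ++ V ++ negA (V ++ Y)) ≈ 0#
  h-vanishes U {W} V {Y} {m} W⁺ Y⁺ small = begin
    hN m (negA (U ++ W) ++ U ++ V ++ negA (V ++ Y))      ≈⟨ hN≋ops _ m ⟩
    H.ops (negA (U ++ W) ++ U ++ V ++ negA (V ++ Y)) δ m ≈⟨ H.ops-cancel-h U W V Y δ m ⟩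
    H.ops (negA W) (H.ops (negA Y) δ) m
      ≈⟨ H.ops-vanishes (negA W) (negA-positive W⁺)
           (H.ops-vanishes (negA Y) (negA-positive Y⁺) δ-vanishes) m bound ⟩
    0# ∎
    where
    bound : length (negA W) Nat.+ (length (negA Y) Nat.+ 1) ≤ m
    bound rewrite length-negA W | length-negA Y = vanishing-bound {length W} {length Y} small

  e-vanishes : ∀ U {W} V {Y m} → Positive W → Positive Y → length W Nat.+ length Y < m →
               eN m (negA U ++ (U ++ W) ++ (V ++ Y) ++ negA V) ≈ 0#
  e-vanishes U {W} V {Y} {m} W⁺ Y⁺ small = begin
    eN m (negA U ++ (U ++ W) ++ (V ++ Y) ++ negA V)      ≈⟨ eN≋ops _ m ⟩
    E.ops (negA U ++ (U ++ W) ++ (V ++ Y) ++ negA V) δ m ≈⟨ E.ops-cancel-e U W V Y δ m ⟩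
    E.ops W (E.ops Y δ) m
      ≈⟨ E.ops-vanishes W W⁺ (E.ops-vanishes Y Y⁺ δ-vanishes) m (vanishing-bound {length W} {length Y} small) ⟩
    0# ∎

  h-block-vanishes : ∀ mu a i b →
    hN (suc (a Nat.+ b)) (negA (Am (mu Nat.+ a)) ++ Am mu ++ Bm i ++ negA (Bm (i Nat.+ b))) ≈ 0#
  h-block-vanishes mu a i b with initial-+ av mu a | initial-+ bv i b
  ... | W , Am-split , W⁺ , W-length | Y , Bm-split , Y⁺ , Y-length = begin
    hN (suc (a Nat.+ b)) (negA (Am (mu Nat.+ a)) ++ Am mu ++ Bm i ++ negA (Bm (i Nat.+ b)))
      ≡⟨ ≡.cong₂ (λ A B → hN (suc (a Nat.+ b)) (negA A ++ Am mu ++ Bm i ++ negA B)) Am-split Bm-split ⟩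
    hN (suc (a Nat.+ b)) (negA (Am mu ++ W) ++ Am mu ++ Bm i ++ negA (Bm i ++ Y))
      ≈⟨ h-vanishes (Am mu) (Bm i) W⁺ Y⁺
           (≡.subst₂ (λ p q → p Nat.+ q < suc (a Nat.+ b)) (≡.sym W-length) (≡.sym Y-length) ℕP.≤-refl) ⟩
    0# ∎

  e-block-vanishes : ∀ mu a i b →
    eN (suc (a Nat.+ b)) (negA (Am i) ++ Am (i Nat.+ b) ++ Bm (mu Nat.+ a) ++ negA (Bm mu)) ≈ 0#
  e-block-vanishes mu a i b with initial-+ av i b | initial-+ bv mu a
  ... | W , Am-split , W⁺ , W-length | Y , Bm-split , Y⁺ , Y-length = begin
    eN (suc (a Nat.+ b)) (negA (Am i) ++ Am (i Nat.+ b) ++ Bm (mu Nat.+ a) ++ negA (Bm mu))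
      ≡⟨ ≡.cong₂ (λ A B → eN (suc (a Nat.+ b)) (negA (Am i) ++ A ++ B ++ negA (Bm mu))) Am-split Bm-split ⟩
    eN (suc (a Nat.+ b)) (negA (Am i) ++ (Am i ++ W) ++ (Bm mu ++ Y) ++ negA (Bm mu))
      ≈⟨ e-vanishes (Am i) (Bm mu) W⁺ Y⁺
           (≡.subst₂ (λ p q → p Nat.+ q < suc (a Nat.+ b)) (≡.sym W-length) (≡.sym Y-length)
                     (s≤s (ℕP.≤-reflexive (ℕP.+-comm b a)))) ⟩
    0# ∎

  h-entry-vanishes : ∀ {la mu i j r s} → ZeroEntry la mu i j r s →
    hZ ((la Nat.+ j) ⊖ (mu Nat.+ i)) (Xr r s ++ negA (Am (la ∸ 1)) ++ Am mu ++ Bm i ++ negA (Bm j)) ≈ 0#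
  h-entry-vanishes (inj₁ degree<0) with ⊖-negative degree<0
  ... | _ , eq rewrite eq = ≈-refl
  h-entry-vanishes {mu = mu} {i} (inj₂ (i≤j , mu<la , s<r))
    with ℕP.m≤n⇒∃[o]m+o≡n mu<la | ℕP.m≤n⇒∃[o]m+o≡n i≤j
  ... | a , refl | b , refl rewrite Xr-empty s<r | entry-degree mu a i b = h-block-vanishes mu a i b

  e-entry-vanishes : ∀ {la mu i j r s} → ZeroEntry la mu i j r s →
    eZ ((la Nat.+ j) ⊖ (mu Nat.+ i)) (Xr r s ++ negA (Am i) ++ Am j ++ Bm (la ∸ 1) ++ negA (Bm mu)) ≈ 0#
  e-entry-vanishes (inj₁ degree<0) with ⊖-negative degree<0
  ... | _ , eq rewrite eq = ≈-refl
  e-entry-vanishes {mu = mu} {i} (inj₂ (i≤j , mu<la , s<r))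
    with ℕP.m≤n⇒∃[o]m+o≡n mu<la | ℕP.m≤n⇒∃[o]m+o≡n i≤j
  ... | a , refl | b , refl rewrite Xr-empty s<r | entry-degree mu a i b = e-block-vanishes mu a i b

  zero-block⇒det≈0 : ∀ n (M : Fin n → Fin n → Carrier) (I J : Fin n → Bool) → n < count I Nat.+ count J →
                     (∀ i j → T (I i) → T (J j) → M i j ≈ 0#) → det n M ≈ 0#
  zero-block⇒det≈0 (suc n) M I J large block = sumL-map-0 term (allFin (suc n))
    where
    minor : Fin (suc n) → Fin n → Fin n → Carrier
    minor j a b = M (suc a) (punchIn j b)
    term : ∀ j → sgn (toℕ j) * (M zero j * det n (minor j)) ≈ 0#
    term j with T? (I zero) ×-dec T? (J j)
    ... | yes (0∈I , j∈J) = ≈-trans (*-congˡ (≈-trans (*-congʳ (block zero j 0∈I j∈J)) (zeroˡ _))) (zeroʳ _)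
    ... | no ¬both        = ≈-trans (*-congˡ (≈-trans (*-congˡ minor≈0) (zeroʳ _))) (zeroʳ _)
      where
      minor≈0 : det n (minor j) ≈ 0#
      minor≈0 = zero-block⇒det≈0 n (minor j) (I ∘ suc) (J ∘ punchIn j) (count-minor I J j ¬both large)
                                 (λ a b → block (suc a) (punchIn j b))

  gSum-inverted : ∀ b {cs} → Any Inverted cs → gSum b cs ≈ 0#
  gSum-inverted false _   = ≈-refl
  gSum-inverted true  inv rewrite candidates-empty inv = ≈-refl

open Nat using (_+_)

module Separation
  {la mu r s : ℕ → ℕ}
  (la-antitone : la Preserves _≤_ ⟶ _≥_) (mu-antitone : mu Preserves _≤_ ⟶ _≥_)
  (overlap⇒mono : ∀ l → mu l < la (suc l) → r l ≤ r (suc l) × s l ≤ s (suc l))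
  {k : ℕ} (mu<la : mu k < la k) (s<r : s k < r k)
  where

  Overlap : ℕ → Set
  Overlap l = mu l < la (suc l)

  Break : ℕ → ℕ → Set
  Break a b = ∃[ l ] l < b × a ≤ l × ¬ Overlap l

  break? : ∀ a b → Dec (Break a b)
  break? a b = ℕP.anyUpTo? (λ l → a ≤? l ×-dec ¬? (mu l <? la (suc l))) b

  Break-irrefl : ∀ a → ¬ Break a a
  Break-irrefl a (l , l<a , a≤l , _) = ℕP.<⇒≱ l<a a≤l

  unbroken-mono : ∀ (f : ℕ → ℕ) → (∀ l → Overlap l → f l ≤ f (suc l)) →
                  ∀ {a b} → a ≤′ b → ¬ Break a b → f a ≤ f b
  unbroken-mono f step ≤′-refl _ = ℕP.≤-refl
  unbroken-mono f step {a} (≤′-step {b} a≤′b) unbroken =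
    ℕP.≤-trans (unbroken-mono f step a≤′b (unbroken ∘ widen)) (step b overlapping)
    where
    widen : Break a b → Break a (suc b)
    widen (l , l<b , a≤l , ¬o) = l , ℕP.m<n⇒m<1+n l<b , a≤l , ¬o
    overlapping : Overlap b
    overlapping = decidable-stable (mu b <? la (suc b)) (λ ¬o → unbroken (b , ℕP.n<1+n b , ℕP.≤′⇒≤ a≤′b , ¬o))

  break⇒degree<0 : ∀ {i j l} → j ≤ l → l < i → ¬ Overlap l → la i + j < mu j + i
  break⇒degree<0 j≤l l<i ¬o =
    ℕP.+-mono-≤-< (ℕP.≤-trans (la-antitone l<i) (ℕP.≤-trans (ℕP.≮⇒≥ ¬o) (mu-antitone j≤l)))
                  (ℕP.≤-<-trans j≤l l<i)

  -- With [p, q] the maximal unbroken run of rows through k, BlockRow = [p, k] ∪ (q, ∞)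
  -- and BlockCol = [0, p) ∪ [k, q].
  BlockRow BlockCol : ℕ → Set
  BlockRow t = (t ≤ k × ¬ Break t k) ⊎ (k < t × Break k t)
  BlockCol t = (t < k × Break t k) ⊎ (k ≤ t × ¬ Break k t)

  blockRow? : ∀ t → Dec (BlockRow t)
  blockRow? t = (t ≤? k ×-dec ¬? (break? t k)) ⊎-dec (k <? t ×-dec break? k t)

  blockCol? : ∀ t → Dec (BlockCol t)
  blockCol? t = (t <? k ×-dec break? t k) ⊎-dec (k ≤? t ×-dec ¬? (break? k t))

  k∈BlockRow : BlockRow k
  k∈BlockRow = inj₁ (ℕP.≤-refl , Break-irrefl k)

  k∈BlockCol : BlockCol k
  k∈BlockCol = inj₂ (ℕP.≤-refl , Break-irrefl k)

  block-covers : ∀ t → BlockRow t ⊎ BlockCol t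
  block-covers t with ℕP.<-cmp t k
  ... | tri≈ _ refl _ = inj₁ k∈BlockRow
  ... | tri< t<k _ _ with break? t k
  ...   | yes b = inj₂ (inj₁ (t<k , b))
  ...   | no ¬b = inj₁ (inj₁ (ℕP.<⇒≤ t<k , ¬b))
  block-covers t | tri> _ _ k<t with break? k t
  ...   | yes b = inj₁ (inj₂ (k<t , b))
  ...   | no ¬b = inj₂ (inj₂ (ℕP.<⇒≤ k<t , ¬b))

  block-zero : ∀ {i j} → BlockRow i → BlockCol j → ZeroEntry (la i) (mu j) i j (r j) (s i)
  block-zero {i} (inj₁ (i≤k , ¬break)) (inj₁ (j<k , l , l<k , j≤l , ¬o)) with l <? i
  ... | yes l<i = inj₁ (break⇒degree<0 j≤l l<i ¬o)
  ... | no l≮i  = contradiction (l , l<k , ℕP.≮⇒≥ l≮i , ¬o) ¬break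
  block-zero (inj₁ (i≤k , ¬break-ik)) (inj₂ (k≤j , ¬break-kj)) =
    inj₂ (ℕP.≤-trans i≤k k≤j ,
          ℕP.≤-<-trans (mu-antitone k≤j) (ℕP.<-≤-trans mu<la (la-antitone i≤k)) ,
          ℕP.≤-<-trans (unbroken-mono s (λ l → proj₂ ∘ overlap⇒mono l) (ℕP.≤⇒≤′ i≤k) ¬break-ik)
                       (ℕP.<-≤-trans s<r (unbroken-mono r (λ l → proj₁ ∘ overlap⇒mono l) (ℕP.≤⇒≤′ k≤j) ¬break-kj)))
  block-zero (inj₂ (k<i , l , l<i , k≤l , ¬o)) (inj₁ (j<k , _)) =
    inj₁ (break⇒degree<0 (ℕP.≤-trans (ℕP.<⇒≤ j<k) k≤l) l<i ¬o)
  block-zero {j = j} (inj₂ (k<i , l , l<i , k≤l , ¬o)) (inj₂ (k≤j , ¬break)) with j ≤? l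
  ... | yes j≤l = inj₁ (break⇒degree<0 j≤l l<i ¬o)
  ... | no j≰l  = contradiction (l , ℕP.≰⇒> j≰l , k≤l , ¬o) ¬break

module Padding {n : ℕ} where

  pad : (Fin n → ℕ) → ℕ → ℕ
  pad f l with l <? n
  ... | yes l<n = f (fromℕ< l<n)
  ... | no _    = 0

  pad-toℕ : ∀ f i → pad f (toℕ i) ≡ f i
  pad-toℕ f i with toℕ i <? n
  ... | yes i<n = ≡.cong f (FinP.fromℕ<-toℕ i i<n)
  ... | no i≮n  = contradiction (FinP.toℕ<n i) i≮n

  pad-antitone : ∀ {f} → IsPartition n f → pad f Preserves _≤_ ⟶ _≥_
  pad-antitone {f} f-partition {a} {b} a≤b with b <? n | a <? n
  ... | no _    | _       = z≤n
  ... | yes b<n | no a≮n  = contradiction (ℕP.≤-<-trans a≤b b<n) a≮n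
  ... | yes b<n | yes a<n = f-partition (fromℕ< a<n) (fromℕ< b<n)
    (≡.subst₂ _≤_ (≡.sym (FinP.toℕ-fromℕ< a<n)) (≡.sym (FinP.toℕ-fromℕ< b<n)) a≤b)

  pad-overlap⇒mono : ∀ {la mu r s : Fin n → ℕ} →
    ((i j : Fin n) → toℕ j ≡ suc (toℕ i) → mu i < la j → (r i ≤ r j) × (s i ≤ s j)) →
    ∀ l → pad mu l < pad la (suc l) → pad r l ≤ pad r (suc l) × pad s l ≤ pad s (suc l)
  pad-overlap⇒mono overlap⇒mono l overlapping with l <? n | suc l <? n
  ... | _       | no _      = contradiction overlapping λ ()
  ... | no l≮n  | yes l+1<n = contradiction (ℕP.<-trans (ℕP.n<1+n l) l+1<n) l≮n
  ... | yes l<n | yes l+1<n = overlap⇒mono (fromℕ< l<n) (fromℕ< l+1<n)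
    (≡.trans (FinP.toℕ-fromℕ< l+1<n) (≡.cong suc (≡.sym (FinP.toℕ-fromℕ< l<n)))) overlapping

lemma4p9 : (R : CommutativeRing 0ℓ 0ℓ) (x α β : ℕ → CommutativeRing.Carrier R)
    (n : ℕ) (la mu r s : Fin n → ℕ) →
    IsPartition n la → IsPartition n mu →
    ((i : Fin n) → 0 < r i) → ((i : Fin n) → 0 < s i) →
    ((i j : Fin n) → toℕ j ≡ suc (toℕ i) → mu i < la j → (r i ≤ r j) × (s i ≤ s j)) →
    (Σ[ k ∈ Fin n ] ((mu k < la k) × (s k < r k))) →
    (CommutativeRing._≈_ R (WithRing.gRow R x α β n la mu r s) (CommutativeRing.0# R))
      × (CommutativeRing._≈_ R (WithRing.detH R x α β n la mu r s) (CommutativeRing.0# R))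
      × (CommutativeRing._≈_ R (WithRing.gCol R x α β n la mu r s) (CommutativeRing.0# R))
      × (CommutativeRing._≈_ R (WithRing.detE R x α β n la mu r s) (CommutativeRing.0# R))
lemma4p9 R x α β n la mu r s la-partition mu-partition _ _ overlap⇒mono (k , mu<la , s<r) =
  gSum-inverted (containedB n la mu) (rowCells-inverted la mu r s k mu<la s<r) ,
  zero-block⇒det≈0 n _ rows cols block-large (λ _ _ i∈ j∈ → h-entry-vanishes (zero-entry i∈ j∈)) ,
  gSum-inverted (containedB n la mu) (colCells-inverted la mu r s k mu<la s<r) ,
  zero-block⇒det≈0 n _ rows cols block-large (λ _ _ i∈ j∈ → e-entry-vanishes (zero-entry i∈ j∈))
  where
  open Vanishing R x α β
  open Padding {n}
  open Separation (pad-antitone la-partition) (pad-antitone mu-partition) (pad-overlap⇒mono overlap⇒mono)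
         (≡.subst₂ _<_ (≡.sym (pad-toℕ mu k)) (≡.sym (pad-toℕ la k)) mu<la)
         (≡.subst₂ _<_ (≡.sym (pad-toℕ s k)) (≡.sym (pad-toℕ r k)) s<r)

  rows cols : Fin n → Bool
  rows t = ⌊ blockRow? (toℕ t) ⌋
  cols t = ⌊ blockCol? (toℕ t) ⌋

  block-large : n < count rows + count cols
  block-large = cover⇒count> rows cols (λ t → Sum.map fromWitness fromWitness (block-covers (toℕ t)))
                             k (fromWitness k∈BlockRow) (fromWitness k∈BlockCol)

  zero-entry : ∀ {i j} → T (rows i) → T (cols j) → ZeroEntry (la i) (mu j) (toℕ i) (toℕ j) (r j) (s i)
  zero-entry {i} {j} i∈ j∈
    rewrite ≡.sym (pad-toℕ la i) | ≡.sym (pad-toℕ mu j) | ≡.sym (pad-toℕ r j) | ≡.sym (pad-toℕ s i)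
    = block-zero (toWitness i∈) (toWitness j∈)
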